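{- Consider the mixed-integer formulation described in the context. Let $(x,y,u)$ be any assignment with $x^t_{od},y^t_r\in\{0,1\}$ and $u^t_v$ integers that satisfies constraints (F4), (F5), (F6), (F7), (F8) and (F12). Then, for every truck $t\in T$ with $D_t\neq\emptyset$, the route $S_t$ satisfies the Hamiltonian cycle condition: (i) every location $v\in P_t=\{0\}\cup\bigcup_{r\in D_t}\{f(r),g(r)\}$ is entered by truck $t$ exactly once and departed by truck $t$ exactly once, where arcs of the form $(v,v)$ are not counted (i.e., there is exactly one $o\neq v$ with $x^t_{ov}=1$ and exactly one $d\neq v$ with $x^t_{vd}=1$); and (ii) $S_t$ contains no subtour, i.e., no directed cycle formed by arcs $(o,d)\in S_t$ with $o\neq d$ that avoids the depot $0$.
   Context: Profit-maximizing multi-vehicle pickup and delivery selection problem (location-based model). $V$ is a finite set of locations containing a depot $0$; $|V|$ denotes its cardinality. $T$ is a finite set of trucks, truck $t$ having capacity $c^t$ and arc costs $l^t_{od}$ ($o,d\in V$). $R$ is a finite set of requests; each $r\in R$ has a payment $w_r$, a volume $q_r$, a loading point $f(r)\in V\setminus\{0\}$ and an unloading point $g(r)\in V\setminus\{0\}$. Variables: Booleans $x^t_{od}$ ($t\in T$, $o,d\in V$; equal to 1 iff truck $t$ traverses arc $(o,d)$), Booleans $y^t_r$ ($t\in T$, $r\in R$; equal to 1 iff request $r$ is assigned to truck $t$), integers $u^t_v$ and $h^t_v$ ($t\in T$, $v\in V\setminus\{0\}$). Write $D_t=\{r\in R: y^t_r=1\}$ (delivery of truck $t$) and $S_t=\{(o,d):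 x^t_{od}=1\}$ (route of truck $t$). Constraints of the formulation (objective: maximize $\sum_{r,t}w_r y^t_r-\sum_{t,o,d}l^t_{od}x^t_{od}$): (F3) $\sum_{t\in T}y^t_r\le 1$ for all $r\in R$; (F4) $y^t_r\le\sum_{o\in V,\,o\neq f(r)}x^t_{of(r)}$ for all $t\in T,r\in R$; (F5) $y^t_r\le\sum_{o\in V,\,o\neq g(r)}x^t_{og(r)}$ for all $t\in T,r\in R$; (F6) $\sum_{d\in V}x^t_{od}-\sum_{d\in V}x^t_{do}=0$ for all $t\in T,o\in V$; (F7) $\sum_{d\in V,\,d\neq o}x^t_{od}\le 1$ for all $t\in T,o\in V$; (F8) $u^t_d-u^t_o\ge 1-|V|(1-x^t_{od})$ for all $t\in T$, $o,d\in V\setminus\{0\}$, $o\neq d$; (F12) $0\le u^t_v\le |V|-2$ for all $t\in T$, $v\in V\setminus\{0\}$. -}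

module Defs where

open import Data.Nat using (ℕ; zero; suc; _+_; _≤_)
open import Data.Integer as ℤ using (ℤ; +_)
open import Data.Fin using (Fin; zero; suc; inject₁; fromℕ)
open import Data.Bool using (Bool; true; false)
open import Data.Product using (Σ; _×_; ∃; ∃-syntax)
open import Data.Sum using (_⊎_)
open import Relation.Nullary using (¬_; yes; no)
open import Relation.Binary.PropositionalEquality using (_≡_; _≢_)
import Data.Fin as F

∑ : ∀ {n} → (Fin n → ℕ) → ℕ
∑ {zero}  f = 0
∑ {suc n} f = f zero + ∑ (λ i → f (suc i))

⟦_⟧ : Bool → ℕ
⟦ true ⟧  = 1
⟦ false ⟧ = 0

⟦_⟧ℤ : Bool → ℤ
⟦ b ⟧ℤ = + ⟦ b ⟧

-- Locations V = Fin (suc n), depot 0 = zero, so |V| = suc n.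
-- Trucks T = Fin m, requests R = Fin k.
-- x : T → V → V → Bool     (x t o d  =  x^t_{od})
-- y : T → R → Bool         (y t r    =  y^t_r)
-- u : T → V → ℤ            (only values at v ≠ 0 are used)

module _ {n m k : ℕ} where

  V = Fin (suc n)

  inDeg : (Fin m → V → V → Bool) → Fin m → V → ℕ
  inDeg x t v = ∑ (λ o → cnt o)
    where cnt : V → ℕ
          cnt o with o F.≟ v
          ... | yes _ = 0
          ... | no  _ = ⟦ x t o v ⟧

  outDeg : (Fin m → V → V → Bool) → Fin m → V → ℕ
  outDeg x t v = ∑ (λ d → cnt d)
    where cnt : V → ℕ
          cnt d with v F.≟ d
          ... | yes _ = 0
          ... | no  _ = ⟦ x t v d ⟧

  fullOut : (Fin m → V → V → Bool) → Fin m → V → ℕ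
  fullOut x t o = ∑ (λ d → ⟦ x t o d ⟧)

  fullIn : (Fin m → V → V → Bool) → Fin m → V → ℕ
  fullIn x t o = ∑ (λ d → ⟦ x t d o ⟧)

  F4 : (Fin k → V) → (Fin m → V → V → Bool) → (Fin m → Fin k → Bool) → Set
  F4 f x y = ∀ t r → ⟦ y t r ⟧ ≤ inDeg x t (f r)

  F5 : (Fin k → V) → (Fin m → V → V → Bool) → (Fin m → Fin k → Bool) → Set
  F5 g x y = ∀ t r → ⟦ y t r ⟧ ≤ inDeg x t (g r)

  F6 : (Fin m → V → V → Bool) → Set
  F6 x = ∀ t o → fullOut x t o ≡ fullIn x t o

  F7 : (Fin m → V → V → Bool) → Set
  F7 x = ∀ t o → outDeg x t o ≤ 1

  F8 : (Fin m → V → V → Bool) → (Fin m → V → ℤ) → Set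
  F8 x u = ∀ t (o d : V) → o ≢ zero → d ≢ zero → o ≢ d →
    (+ 1) ℤ.- (+ suc n) ℤ.* ((+ 1) ℤ.- ⟦ x t o d ⟧ℤ) ℤ.≤ u t d ℤ.- u t o

  F12 : (Fin m → V → ℤ) → Set
  F12 u = ∀ t (v : V) → v ≢ zero → (+ 0 ℤ.≤ u t v) × (u t v ℤ.≤ (+ suc n) ℤ.- (+ 2))

  DeliveryNonempty : (Fin m → Fin k → Bool) → Fin m → Set
  DeliveryNonempty y t = ∃[ r ] (y t r ≡ true)

  InP : (Fin k → V) → (Fin k → V) → (Fin m → Fin k → Bool) → Fin m → V → Set
  InP f g y t v = (v ≡ zero) ⊎ (∃[ r ] (y t r ≡ true × (v ≡ f r ⊎ v ≡ g r)))

  Arc : (Fin m → V → V → Bool) → Fin m → V → V → Set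
  Arc x t o d = (o ≢ d) × (x t o d ≡ true)

  Subtour : (Fin m → V → V → Bool) → Fin m → Set
  Subtour x t =
    Σ ℕ λ j → Σ (Fin (suc j) → V) λ c →
      (∀ i → c i ≢ zero) ×
      (∀ (i : Fin j) → Arc x t (c (inject₁ i)) (c (suc i))) ×
      Arc x t (c (fromℕ j)) (c zero)

{-# OPTIONS --safe #-}
module Submission where

-- Flow conservation (F6) with loops discounted makes in- and out-degree
-- equal at every location, so by (F7) a location that is entered at all is
-- entered and left exactly once; (F4) and (F5) make the loading and
-- unloading points of D_t entered.  By (F8) the potential u strictly
-- increases along every arc between non-depot locations, which rules out
-- subtours.  Walking backwards from an entered loading point strictly
-- decreases u, which (F12) bounds below by 0, so the walk reaches the
-- depot: the depot is left, hence entered.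

open import Defs
open import Data.Nat as ℕ using (ℕ; zero; suc; _+_)
import Data.Nat.Properties as ℕ
open import Data.Nat.Induction using (<-wellFounded)
open import Data.Integer as ℤ using (ℤ; +_; +≤+; +<+)
import Data.Integer.Properties as ℤ
open import Data.Fin using (Fin; zero; suc; inject₁; fromℕ; _≟_)
open import Data.Fin.Properties using (suc-injective)
open import Data.Bool using (Bool; true)
open import Data.Product using (_×_; _,_; proj₁; ∃-syntax)
open import Data.Sum using (_⊎_; inj₁; inj₂)
open import Function using (_∘_)
open import Relation.Nullary using (¬_; yes; no; contradiction)
open import Relation.Binary.PropositionalEquality
import Relation.Binary.Construct.On as On
open import Induction.WellFounded using (module All)
open import Algebra.Properties.CommutativeSemigroup ℕ.+-commutativeSemigroup
  using (x∙yz≈y∙xz)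

∑-cong : ∀ {N} {f g : Fin N → ℕ} → (∀ i → f i ≡ g i) → ∑ f ≡ ∑ g
∑-cong {zero}  f≗g = refl
∑-cong {suc N} f≗g = cong₂ _+_ (f≗g zero) (∑-cong (f≗g ∘ suc))

∑-punctured : ∀ {N} {h f : Fin N → ℕ} v → f v ≡ 0 → (∀ i → i ≢ v → f i ≡ h i) →
              ∑ h ≡ h v + ∑ f
∑-punctured {suc N} {h} {f} zero fv≡0 f≡h = begin
  h zero + ∑ (h ∘ suc)  ≡⟨ cong (λ s → h zero + s) (∑-cong λ i → sym (f≡h (suc i) λ ())) ⟩
  h zero + ∑ (f ∘ suc)  ≡⟨ cong (λ a → h zero + (a + ∑ (f ∘ suc))) fv≡0 ⟨
  h zero + ∑ f          ∎
  where open ≡-Reasoning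
∑-punctured {suc N} {h} {f} (suc v) fv≡0 f≡h = begin
  h zero + ∑ (h ∘ suc)
    ≡⟨ cong (λ s → h zero + s) (∑-punctured v fv≡0 λ i i≢v → f≡h (suc i) (i≢v ∘ suc-injective)) ⟩
  h zero + (h (suc v) + ∑ (f ∘ suc))
    ≡⟨ x∙yz≈y∙xz (h zero) (h (suc v)) _ ⟩
  h (suc v) + (h zero + ∑ (f ∘ suc))
    ≡⟨ cong (λ a → h (suc v) + (a + ∑ (f ∘ suc))) (f≡h zero λ ()) ⟨
  h (suc v) + ∑ f
    ∎
  where open ≡-Reasoning

≤-∑ : ∀ {N} (f : Fin N → ℕ) i → f i ℕ.≤ ∑ f
≤-∑ f zero    = ℕ.m≤m+n (f zero) _
≤-∑ f (suc i) = ℕ.≤-trans (≤-∑ (f ∘ suc) i) (ℕ.m≤n+m _ (f zero))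

∑-positive : ∀ {N} (f : Fin N → ℕ) → 0 ℕ.< ∑ f → ∃[ i ] 0 ℕ.< f i
∑-positive {suc N} f 0<∑f with f zero in f0≡
... | suc _ = zero , subst (0 ℕ.<_) (sym f0≡) ℕ.z<s
... | zero  with i , 0<fi ← ∑-positive (f ∘ suc) 0<∑f = suc i , 0<fi

0<⟦b⟧⇒b≡true : ∀ {b} → 0 ℕ.< ⟦ b ⟧ → b ≡ true
0<⟦b⟧⇒b≡true {true} _ = refl

-- `inDeg` and `outDeg` sum local functions of `Defs` that cannot be named
-- directly; unifying `a + ∑ g` with the unfolded degree recovers them.
summand : ∀ {N a} {g : Fin N → ℕ} (s : ℕ) → s ≡ a + ∑ g → Fin (suc N) → ℕ
summand {a = a} _ _ zero    = a
summand {g = g} _ _ (suc i) = g i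

module Degrees {n m k : ℕ} (x : Fin m → Fin (suc n) → Fin (suc n) → Bool) (t : Fin m) where

  private
    inDeg′ outDeg′ : Fin (suc n) → ℕ
    inDeg′  = inDeg  {n} {m} {k} x t
    outDeg′ = outDeg {n} {m} {k} x t

  inTerm outTerm : Fin (suc n) → Fin (suc n) → ℕ
  inTerm  v = summand (inDeg′ v) refl
  outTerm v = summand (outDeg′ v) refl

  inTerm-self : ∀ v → inTerm v v ≡ 0
  inTerm-self zero = refl
  inTerm-self (suc v) with suc v ≟ suc v
  ... | yes _  = refl
  ... | no v≢v = contradiction refl v≢v

  inTerm-other : ∀ v o → o ≢ v → inTerm v o ≡ ⟦ x t o v ⟧
  inTerm-other v zero o≢v with zero ≟ v
  ... | yes o≡v = contradiction o≡v o≢v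
  ... | no _    = refl
  inTerm-other v (suc o) o≢v with suc o ≟ v
  ... | yes o≡v = contradiction o≡v o≢v
  ... | no _    = refl

  outTerm-self : ∀ v → outTerm v v ≡ 0
  outTerm-self zero = refl
  outTerm-self (suc v) with suc v ≟ suc v
  ... | yes _  = refl
  ... | no v≢v = contradiction refl v≢v

  outTerm-other : ∀ v d → d ≢ v → outTerm v d ≡ ⟦ x t v d ⟧
  outTerm-other v zero d≢v with v ≟ zero
  ... | yes v≡d = contradiction (sym v≡d) d≢v
  ... | no _    = refl
  outTerm-other v (suc d) d≢v with v ≟ suc d
  ... | yes v≡d = contradiction (sym v≡d) d≢v
  ... | no _    = refl

  fullIn≡loop+inDeg : ∀ v → fullIn {n} {m} {k} x t v ≡ ⟦ x t v v ⟧ + inDeg′ v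
  fullIn≡loop+inDeg v = ∑-punctured {h = λ o → ⟦ x t o v ⟧} {inTerm v} v
    (inTerm-self v) (inTerm-other v)

  fullOut≡loop+outDeg : ∀ v → fullOut {n} {m} {k} x t v ≡ ⟦ x t v v ⟧ + outDeg′ v
  fullOut≡loop+outDeg v = ∑-punctured {h = λ d → ⟦ x t v d ⟧} {outTerm v} v
    (outTerm-self v) (outTerm-other v)

  arc⇒0<inDeg : ∀ {o d} → Arc {n} {m} {k} x t o d → 0 ℕ.< inDeg′ d
  arc⇒0<inDeg {o} {d} (o≢d , xod) = ℕ.≤-trans (ℕ.≤-reflexive (begin
    1            ≡⟨ cong ⟦_⟧ xod ⟨
    ⟦ x t o d ⟧  ≡⟨ inTerm-other d o o≢d ⟨
    inTerm d o   ∎)) (≤-∑ (inTerm d) o)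
    where open ≡-Reasoning

  arc⇒0<outDeg : ∀ {o d} → Arc {n} {m} {k} x t o d → 0 ℕ.< outDeg′ o
  arc⇒0<outDeg {o} {d} (o≢d , xod) = ℕ.≤-trans (ℕ.≤-reflexive (begin
    1            ≡⟨ cong ⟦_⟧ xod ⟨
    ⟦ x t o d ⟧  ≡⟨ outTerm-other o d (o≢d ∘ sym) ⟨
    outTerm o d  ∎)) (≤-∑ (outTerm o) d)
    where open ≡-Reasoning

  0<inDeg⇒arc : ∀ {v} → 0 ℕ.< inDeg′ v → ∃[ o ] Arc {n} {m} {k} x t o v
  0<inDeg⇒arc {v} 0<inDeg with o , 0<term ← ∑-positive (inTerm v) 0<inDeg with o ≟ v
  ... | yes refl = contradiction (inTerm-self v) (ℕ.<⇒≢ 0<term ∘ sym)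
  ... | no o≢v   = o , o≢v , 0<⟦b⟧⇒b≡true (subst (0 ℕ.<_) (inTerm-other v o o≢v) 0<term)

1≤j-i⇒i<j : ∀ {i j} → + 1 ℤ.≤ j ℤ.- i → i ℤ.< j
1≤j-i⇒i<j {i} {j} 1≤j-i = ℤ.suc[i]≤j⇒i<j (begin
  + 1 ℤ.+ i          ≤⟨ ℤ.+-monoˡ-≤ i 1≤j-i ⟩
  j ℤ.- i ℤ.+ i      ≡⟨ ℤ.+-assoc j (ℤ.- i) i ⟩
  j ℤ.+ (ℤ.- i ℤ.+ i) ≡⟨ cong (λ s → j ℤ.+ s) (ℤ.+-inverseˡ i) ⟩
  j ℤ.+ + 0          ≡⟨ ℤ.+-identityʳ j ⟩
  j                  ∎)
  where open ℤ.≤-Reasoning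

0≤i∧i<j⇒∣i∣<∣j∣ : ∀ {i j} → + 0 ℤ.≤ i → i ℤ.< j → ℤ.∣ i ∣ ℕ.< ℤ.∣ j ∣
0≤i∧i<j⇒∣i∣<∣j∣ (+≤+ _) (+<+ i<j) = i<j

potential-≤-along-path : ∀ {A : Set} (R : A → A → Set) (φ : A → ℤ) →
  (∀ {a b} → R a b → φ a ℤ.< φ b) →
  ∀ j (c : Fin (suc j) → A) → (∀ (i : Fin j) → R (c (inject₁ i)) (c (suc i))) →
  φ (c zero) ℤ.≤ φ (c (fromℕ j))
potential-≤-along-path R φ mono zero    c steps = ℤ.≤-refl
potential-≤-along-path R φ mono (suc j) c steps = ℤ.≤-trans
  (potential-≤-along-path R φ mono j (c ∘ inject₁) (steps ∘ inject₁))
  (ℤ.<⇒≤ (mono (steps (fromℕ j))))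

measure-descent : ∀ {A : Set} {P : A → Set} {Q : Set} (φ : A → ℕ) →
  (∀ {a} → P a → Q ⊎ ∃[ b ] P b × φ b ℕ.< φ a) →
  ∀ {a} → P a → Q
measure-descent {P = P} {Q} φ step {a} = All.wfRec (On.wellFounded φ <-wellFounded) _
  (λ a → P a → Q) recurse a
  where
  recurse : ∀ a → (∀ {b} → φ b ℕ.< φ a → P b → Q) → P a → Q
  recurse a ih pa with step pa
  ... | inj₁ q              = q
  ... | inj₂ (b , pb , φb<φa) = ih φb<φa pb

module Routes {n m k : ℕ}
  (x : Fin m → Fin (suc n) → Fin (suc n) → Bool) (u : Fin m → Fin (suc n) → ℤ)
  (f6 : F6 {n} {m} {k} x) (f7 : F7 {n} {m} {k} x)
  (f8 : F8 {n} {m} {k} x u) (f12 : F12 {n} {m} {k} u)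
  (t : Fin m) where

  open Degrees {n} {m} {k} x t

  private
    inDeg′ outDeg′ : Fin (suc n) → ℕ
    inDeg′  = inDeg  {n} {m} {k} x t
    outDeg′ = outDeg {n} {m} {k} x t
    Arc′ : Fin (suc n) → Fin (suc n) → Set
    Arc′ = Arc {n} {m} {k} x t

  inDeg≡outDeg : ∀ v → inDeg′ v ≡ outDeg′ v
  inDeg≡outDeg v = ℕ.+-cancelˡ-≡ ⟦ x t v v ⟧ _ _ (begin
    ⟦ x t v v ⟧ + inDeg′ v    ≡⟨ fullIn≡loop+inDeg v ⟨
    fullIn {n} {m} {k} x t v  ≡⟨ f6 t v ⟨
    fullOut {n} {m} {k} x t v ≡⟨ fullOut≡loop+outDeg v ⟩
    ⟦ x t v v ⟧ + outDeg′ v   ∎)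
    where open ≡-Reasoning

  entered⇒degrees≡1 : ∀ v → 0 ℕ.< inDeg′ v → inDeg′ v ≡ 1 × outDeg′ v ≡ 1
  entered⇒degrees≡1 v 0<inDeg = inDeg≡1 , trans (sym (inDeg≡outDeg v)) inDeg≡1
    where
    inDeg≡1 : inDeg′ v ≡ 1
    inDeg≡1 = ℕ.≤-antisym (subst (ℕ._≤ 1) (sym (inDeg≡outDeg v)) (f7 t v)) 0<inDeg

  u-increasing : ∀ {o d} → o ≢ zero → d ≢ zero → Arc′ o d → u t o ℤ.< u t d
  u-increasing {o} {d} o≢0 d≢0 (o≢d , xod) =
    1≤j-i⇒i<j (subst (ℤ._≤ u t d ℤ.- u t o) slack≡1 (f8 t o d o≢0 d≢0 o≢d))
    where
    slack≡1 : + 1 ℤ.- + suc n ℤ.* (+ 1 ℤ.- ⟦ x t o d ⟧ℤ) ≡ + 1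
    slack≡1 rewrite xod | ℤ.*-zeroʳ (+ suc n) = refl

  DepotFreeArc : Fin (suc n) → Fin (suc n) → Set
  DepotFreeArc o d = o ≢ zero × d ≢ zero × Arc′ o d

  no-subtour : ¬ Subtour {n} {m} {k} x t
  no-subtour (j , c , c≢0 , steps , closing) = ℤ.<-irrefl refl (ℤ.≤-<-trans
    (potential-≤-along-path DepotFreeArc (u t) increasing j c
      λ i → c≢0 _ , c≢0 _ , steps i)
    (increasing (c≢0 _ , c≢0 _ , closing)))
    where
    increasing : ∀ {o d} → DepotFreeArc o d → u t o ℤ.< u t d
    increasing (o≢0 , d≢0 , arc) = u-increasing o≢0 d≢0 arc

  depot-entered : ∀ {v} → v ≢ zero → 0 ℕ.< inDeg′ v → 0 ℕ.< inDeg′ zero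
  depot-entered v≢0 0<inDeg = subst (0 ℕ.<_) (sym (inDeg≡outDeg zero))
    (measure-descent (ℤ.∣_∣ ∘ u t) predecessor (v≢0 , 0<inDeg))
    where
    predecessor : ∀ {v} → v ≢ zero × 0 ℕ.< inDeg′ v →
      0 ℕ.< outDeg′ zero ⊎ ∃[ o ] (o ≢ zero × 0 ℕ.< inDeg′ o) × ℤ.∣ u t o ∣ ℕ.< ℤ.∣ u t v ∣
    predecessor (v≢0 , 0<inDeg) with o , arc ← 0<inDeg⇒arc 0<inDeg with o ≟ zero
    ... | yes refl = inj₁ (arc⇒0<outDeg arc)
    ... | no o≢0   = inj₂ (o , (o≢0 , subst (0 ℕ.<_) (sym (inDeg≡outDeg o)) (arc⇒0<outDeg arc))
                            , 0≤i∧i<j⇒∣i∣<∣j∣ (proj₁ (f12 t o o≢0)) (u-increasing o≢0 v≢0 arc))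

theorem1 : (n m k : ℕ)
    → (f g : Fin k → Fin (suc n))
    → (∀ r → f r ≢ zero) → (∀ r → g r ≢ zero)
    → (x : Fin m → Fin (suc n) → Fin (suc n) → Bool)
    → (y : Fin m → Fin k → Bool)
    → (u : Fin m → Fin (suc n) → ℤ)
    → F4 {n} {m} {k} f x y → F5 {n} {m} {k} g x y → F6 {n} {m} {k} x → F7 {n} {m} {k} x
    → F8 {n} {m} {k} x u → F12 {n} {m} {k} u
    → ∀ (t : Fin m) → DeliveryNonempty {n} {m} {k} y t
    → (∀ (v : Fin (suc n)) → InP {n} {m} {k} f g y t v
         → inDeg {n} {m} {k} x t v ≡ 1 × outDeg {n} {m} {k} x t v ≡ 1)
      × ¬ Subtour {n} {m} {k} x t
theorem1 n m k f g f≢0 _ x y u f4 f5 f6 f7 f8 f12 t (r , yr) = visited-once , no-subtour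
  where
  open Routes {n} {m} {k} x u f6 f7 f8 f12 t

  assigned⇒entered : ∀ {r} w → y t r ≡ true → ⟦ y t r ⟧ ℕ.≤ inDeg {n} {m} {k} x t w →
                     0 ℕ.< inDeg {n} {m} {k} x t w
  assigned⇒entered _ assigned = subst (ℕ._≤ _) (cong ⟦_⟧ assigned)

  visited-once : ∀ v → InP {n} {m} {k} f g y t v →
                 inDeg {n} {m} {k} x t v ≡ 1 × outDeg {n} {m} {k} x t v ≡ 1
  visited-once v (inj₁ refl) =
    entered⇒degrees≡1 v (depot-entered (f≢0 r) (assigned⇒entered (f r) yr (f4 t r)))
  visited-once v (inj₂ (r′ , yr′ , inj₁ refl)) = entered⇒degrees≡1 v (assigned⇒entered v yr′ (f4 t r′))
  visited-once v (inj₂ (r′ , yr′ , inj₂ refl)) = entered⇒degrees≡1 v (assigned⇒entered v yr′ (f5 t r′))
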